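{- For every positive integer $r$ and every integer $n\ge 0$, $$\mathtt{Cat}(r,n)=\sum_{w\in\mathtt{Dyck}(n)}\mathrm{wt}^{(r)}(w),$$ where $\mathtt{Cat}(r,n)$, $\mathtt{Dyck}(n)$ and $\mathrm{wt}^{(r)}$ are as defined in the context.
   Context: Let $\mathtt{Cat}(x)=\frac{1-\sqrt{1-4x}}{2x}=\sum_{n\ge0}\frac{1}{n+1}\binom{2n}{n}x^n$ be the Catalan generating function, and define $\mathtt{Cat}(r,n)$ by $\mathtt{Cat}(x)^r=\sum_{n\ge 0}\mathtt{Cat}(r,n)x^n$, i.e. $\mathtt{Cat}(r,n)=\frac{r}{n+r}\binom{2n+r-1}{n}$. A Dyck word of size $n$ is a word $w=w_1\cdots w_{2n}\in\{0,1\}^{2n}$ with equally many $0$'s and $1$'s such that every prefix $w_1\cdots w_i$ contains at least as many $0$'s as $1$'s; $\mathtt{Dyck}(n)$ is the set of Dyck words of size $n$ (for $n=0$ it consists of the empty word). For a nonempty Dyck word $w$, let $p(w)$ be the smallest $p\ge1$ such that $w_1\cdots w_p$ contains equally many $0$'s and $1$'s. The weight $\mathrm{wt}^{(r)}(w)$ of a Dyck word $w$ of size $n$ is defined recursively: if $w=(01)^n$ (including the empty word for $n=0$), then $\mathrm{wt}^{(r)}(w)=\binom{r+n-1}{n}$; otherwise $\mathrm{wt}^{(r)}(w)=\mathrm{wt}^{(r)}(w')$, where $w'$ is the Dyck word of size $n-1$ obtained from $w$ by deleting its first letter and its $p(w)$-th letter. -}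

module Defs where

open import Data.Nat using (ℕ; zero; suc; _+_; _*_; _∸_)
open import Data.Nat.Combinatorics using (_C_)
open import Data.Bool using (Bool; true; false; _∧_)
open import Data.List using (List; []; _∷_; _++_; map; concatMap; filterᵇ)
open import Data.Nat.ListAction using (sum)
open import Data.Maybe using (Maybe; just; nothing)
open import Data.Product using (_×_; _,_)

-- Letters: false = 0, true = 1.  Words are List Bool.

allWords : ℕ → List (List Bool)
allWords zero    = [] ∷ []
allWords (suc m) = concatMap (λ w → (false ∷ w) ∷ (true ∷ w) ∷ []) (allWords m)

-- isDyckFrom h w : starting at height h (#0's minus #1's so far), every prefix
-- keeps height ≥ 0 and the final height is 0.
isDyckFrom : ℕ → List Bool → Bool
isDyckFrom zero    []           = true
isDyckFrom (suc _) []           = false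
isDyckFrom h       (false ∷ w)  = isDyckFrom (suc h) w
isDyckFrom zero    (true ∷ w)   = false
isDyckFrom (suc h) (true ∷ w)   = isDyckFrom h w

isDyck : List Bool → Bool
isDyck = isDyckFrom 0

Dyck : ℕ → List (List Bool)
Dyck n = filterᵇ isDyck (allWords (2 * n))

-- Cat(r,n) = r/(n+r) * binom(2n+r-1, n)  (defined for r ≥ 1, n ≥ 0).
-- Kept as its numerator/denominator to avoid division:  Cat(r,n) = catNum r n / catDen r n.
catNum : ℕ → ℕ → ℕ
catNum r n = r * ((2 * n + r ∸ 1) C n)

catDen : ℕ → ℕ → ℕ
catDen r n = n + r

isZigzag : List Bool → Bool
isZigzag []                    = true
isZigzag (false ∷ true ∷ w)    = isZigzag w
isZigzag _                     = false

-- For w = 0 w₂ w₃ ..., split off the first return:  given the tail after the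
-- leading 0, returns (u , v) with tail = u 1 v where u 1 is the shortest
-- prefix bringing the height from 1 back to 0.  Then deleting the first
-- letter and the p(w)-th letter of w yields u ++ v.
firstReturn : ℕ → List Bool → Maybe (List Bool × List Bool)
firstReturn h       []          = nothing
firstReturn h       (false ∷ w) with firstReturn (suc h) w
... | just (u , v) = just (false ∷ u , v)
... | nothing      = nothing
firstReturn zero    (true ∷ w)  = just ([] , w)
firstReturn (suc h) (true ∷ w) with firstReturn h w
... | just (u , v) = just (true ∷ u , v)
... | nothing      = nothing

reduce : List Bool → List Bool
reduce []          = []
reduce (b ∷ w) with firstReturn 0 w
... | just (u , v) = u ++ v
... | nothing      = w   -- not reached for Dyck words

-- wt^(r)(w) for a Dyck word of size n; the fuel argument is the size n.
wtSize : ℕ → ℕ → List Bool → ℕ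
wtSize r zero    w = 1   -- size 0: empty word, binom(r-1,0) = 1
wtSize r (suc n) w with isZigzag w
... | true  = (r + suc n ∸ 1) C (suc n)
... | false = wtSize r n (reduce w)

dyckWeightSum : ℕ → ℕ → ℕ
dyckWeightSum r n = sum (map (wtSize r n) (Dyck n))

-- Call a step from height 1 down to height 0 a return. Deleting the first letter
-- and the first return maps the Dyck words of size n + 1 onto those of size n;
-- the preimages of a word x with ρ returns are obtained by inserting the first
-- return, have ρ + 1, ρ, …, 1 returns, and all carry the weight of x except
-- for (01)^(n+1). So the total weights R_r(k, n) of the words with at least k
-- returns satisfy a recurrence in n, from which induction on n gives
-- R_{r+1}(k, n+1) = R_r(k, n+1) + R_{r+2}(k, n), the counterpart of
-- Cat^(r+1) = Cat^r + x Cat^(r+2). For k = 0 this leads to the ballot formula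
-- R_r(0, n) = C(2n+r-1, n) - C(2n+r-1, n-1), which is Cat(r, n) by absorption.
module Submission where

open import Defs
open import Data.Bool using (Bool; true; false; if_then_else_; T)
open import Data.Empty using (⊥-elim)
open import Data.Nat
open import Data.Nat.Properties
open import Algebra.Properties.CommutativeSemigroup +-commutativeSemigroup
  using (interchange; xy∙z≈xz∙y; xy∙z≈zy∙x; xy∙z≈y∙zx; x∙yz≈yx∙z)
open import Data.Nat.Combinatorics
  using (_C_; nCk+nC[k+1]≡[n+1]C[k+1]; nCk≡nC[n∸k]; k>n⇒nCk≡0; nC1≡n)
open import Data.Nat.Tactic.RingSolver using (solve-∀)
open import Data.Nat.ListAction using (sum)
open import Data.Nat.ListAction.Properties using (sum-++)
open import Data.List using (List; []; _∷_; _++_; map; concatMap; filterᵇ; length; applyDownFrom)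
open import Data.List.Properties using (map-++; map-∘; map-cong; map-cong-local)
open import Data.List.Relation.Unary.All as All using (All; []; _∷_)
open import Data.List.Relation.Unary.All.Properties using (map⁺; map⁻)
open import Data.Maybe using (just)
open import Data.Product using (∃-syntax; _×_; _,_)
open import Relation.Binary.PropositionalEquality
open import Relation.Nullary using (yes; no)

C-pascal : ∀ n k → suc n C suc k ≡ n C k + n C suc k
C-pascal n k = sym (nCk+nC[k+1]≡[n+1]C[k+1] n k)

C-absorption : ∀ n k → suc k * (n C suc k) + k * (n C k) ≡ n * (n C k)
C-absorption zero    zero    = refl
C-absorption zero    (suc k) = cong₂ _+_ (*-zeroʳ (suc (suc k))) (*-zeroʳ (suc k))
C-absorption (suc n) zero    =
  trans (+-identityʳ _) (trans (*-identityˡ _) (trans (nC1≡n (suc n)) (sym (*-identityʳ (suc n)))))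
C-absorption (suc n) (suc k) = begin
    suc (suc k) * (suc n C suc (suc k)) + suc k * (suc n C suc k)
      ≡⟨ cong₂ (λ x y → suc (suc k) * x + suc k * y) (C-pascal n (suc k)) (C-pascal n k) ⟩
    suc (suc k) * (b + c) + suc k * (a + b)
      ≡⟨ regroup k a b c ⟩
    (suc (suc k) * c + suc k * b) + (suc k * b + k * a) + (a + b)
      ≡⟨ cong₂ (λ x y → x + y + (a + b)) (C-absorption n (suc k)) (C-absorption n k) ⟩
    n * b + n * a + (a + b)
      ≡⟨ collect n a b ⟩
    suc n * (a + b)
      ≡⟨ cong (suc n *_) (C-pascal n k) ⟨
    suc n * (suc n C suc k) ∎
  where
    open ≡-Reasoning
    a b c : ℕ
    a = n C k
    b = n C suc k
    c = n C suc (suc k)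
    regroup : ∀ k a b c → suc (suc k) * (b + c) + suc k * (a + b)
                        ≡ (suc (suc k) * c + suc k * b) + (suc k * b + k * a) + (a + b)
    regroup = solve-∀
    collect : ∀ n a b → n * b + n * a + (a + b) ≡ suc n * (a + b)
    collect = solve-∀

C-exchange : ∀ N n → suc N C suc (suc n) + N C n ≡ N C suc (suc n) + suc N C suc n
C-exchange N n = begin
    suc N C suc (suc n) + N C n
      ≡⟨ cong (_+ N C n) (C-pascal N (suc n)) ⟩
    N C suc n + N C suc (suc n) + N C n
      ≡⟨ xy∙z≈y∙zx (N C suc n) (N C suc (suc n)) (N C n) ⟩
    N C suc (suc n) + (N C n + N C suc n)
      ≡⟨ cong (N C suc (suc n) +_) (C-pascal N n) ⟨
    N C suc (suc n) + suc N C suc n ∎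
  where open ≡-Reasoning

-- The weight that wtSize r m gives to (01)^m.
zigzagWeight : ℕ → ℕ → ℕ
zigzagWeight r m = (r + m ∸ 1) C m

zigzagWeight-suc : ∀ r m → zigzagWeight r (suc m) ≡ (r + m) C suc m
zigzagWeight-suc r m = cong (λ t → (t ∸ 1) C suc m) (+-suc r m)

zigzagWeight-exchange : ∀ r n → zigzagWeight (suc r) (suc (suc n)) + zigzagWeight (suc (suc r)) n
                              ≡ zigzagWeight r (suc (suc n)) + zigzagWeight (suc (suc r)) (suc n)
zigzagWeight-exchange r n = begin
    (r + suc (suc n)) C suc (suc n) + suc (r + n) C n
      ≡⟨ cong₂ (λ s t → s C suc (suc n) + t C n) (+-suc r (suc n)) (sym (+-suc r n)) ⟩
    suc N C suc (suc n) + N C n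
      ≡⟨ C-exchange N n ⟩
    N C suc (suc n) + suc N C suc n
      ≡⟨ cong (_+ suc N C suc n) (zigzagWeight-suc r (suc n)) ⟨
    zigzagWeight r (suc (suc n)) + zigzagWeight (suc (suc r)) (suc n) ∎
  where
    open ≡-Reasoning
    N : ℕ
    N = r + suc n

zigzagWeight-one : ∀ r → zigzagWeight (suc r) 1 ≡ zigzagWeight r 1 + 1
zigzagWeight-one r = begin
    (r + 1) C 1      ≡⟨ nC1≡n (r + 1) ⟩
    r + 1            ≡⟨ cong (_+ 1) (nC1≡n r) ⟨
    r C 1 + 1        ≡⟨ cong (λ t → t C 1 + 1) (+-identityʳ r) ⟨
    (r + 0) C 1 + 1  ≡⟨ cong (_+ 1) (zigzagWeight-suc r 0) ⟨
    zigzagWeight r 1 + 1 ∎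
  where open ≡-Reasoning

zigzagWeight-zero : ∀ m → zigzagWeight 0 (suc m) ≡ 0
zigzagWeight-zero m = k>n⇒nCk≡0 (n<1+n m)

sumRange : (ℕ → ℕ) → ℕ → ℕ → ℕ
sumRange f a zero    = 0
sumRange f a (suc c) = f a + sumRange f (suc a) c

sumRange-snoc : ∀ f a c → sumRange f a (suc c) ≡ sumRange f a c + f (a + c)
sumRange-snoc f a zero    = trans (+-comm (f a) 0) (cong (λ j → 0 + f j) (sym (+-identityʳ a)))
sumRange-snoc f a (suc c) = begin
    f a + sumRange f (suc a) (suc c)          ≡⟨ cong (f a +_) (sumRange-snoc f (suc a) c) ⟩
    f a + (sumRange f (suc a) c + f (suc a + c)) ≡⟨ +-assoc (f a) _ _ ⟨
    f a + sumRange f (suc a) c + f (suc a + c)   ≡⟨ cong (λ j → f a + sumRange f (suc a) c + f j) (+-suc a c) ⟨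
    f a + sumRange f (suc a) c + f (a + suc c)   ∎
  where open ≡-Reasoning

sumRange-cong : ∀ f g a c → (∀ j → j < a + c → f j ≡ g j) → sumRange f a c ≡ sumRange g a c
sumRange-cong f g a zero    f≡g = refl
sumRange-cong f g a (suc c) f≡g =
  cong₂ _+_ (f≡g a (subst (a <_) (sym (+-suc a c)) (s≤s (m≤m+n a c))))
            (sumRange-cong f g (suc a) c (λ j j< → f≡g j (subst (j <_) (sym (+-suc a c)) j<)))

sumRange-+ : ∀ f g a c → sumRange (λ j → f j + g j) a c ≡ sumRange f a c + sumRange g a c
sumRange-+ f g a zero    = refl
sumRange-+ f g a (suc c) = trans (cong (f a + g a +_) (sumRange-+ f g (suc a) c))
                                 (interchange (f a) (g a) _ _)

sumRange-zero : ∀ f a c → (∀ j → f j ≡ 0) → sumRange f a c ≡ 0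
sumRange-zero f a zero    f≡0 = refl
sumRange-zero f a (suc c) f≡0 = cong₂ _+_ (f≡0 a) (sumRange-zero f (suc a) c f≡0)

if-≤ᵇ : ∀ {m n} (x y : ℕ) → m ≤ n → (if m ≤ᵇ n then x else y) ≡ x
if-≤ᵇ {m} {n} x y m≤n with m ≤ᵇ n | ≤⇒≤ᵇ m≤n
... | true  | _  = refl
... | false | ()

if-≰ᵇ : ∀ {m n} (x y : ℕ) → n < m → (if m ≤ᵇ n then x else y) ≡ y
if-≰ᵇ {m} {n} x y n<m with m ≤ᵇ n in m≤ᵇn
... | false = refl
... | true  = ⊥-elim (<⇒≱ n<m (≤ᵇ⇒≤ m n (subst T (sym m≤ᵇn) _)))

≤ᵇ-suc-pred : ∀ k i → (k ≤ᵇ suc i) ≡ (pred k ≤ᵇ i)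
≤ᵇ-suc-pred zero          i = refl
≤ᵇ-suc-pred (suc zero)    i = refl
≤ᵇ-suc-pred (suc (suc k)) i = refl

guarded-step : ∀ a ρ w → (if a ≤ᵇ ρ then w else 0) + (ρ ∸ a) * w ≡ (suc ρ ∸ a) * w
guarded-step a ρ w with a ≤? ρ
... | yes a≤ρ = begin
  (if a ≤ᵇ ρ then w else 0) + (ρ ∸ a) * w  ≡⟨ cong (_+ (ρ ∸ a) * w) (if-≤ᵇ w 0 a≤ρ) ⟩
  suc (ρ ∸ a) * w                          ≡⟨ cong (_* w) (+-∸-assoc 1 a≤ρ) ⟨
  (suc ρ ∸ a) * w                          ∎
  where open ≡-Reasoning
... | no a≰ρ = begin
  (if a ≤ᵇ ρ then w else 0) + (ρ ∸ a) * w  ≡⟨ cong₂ (λ x d → x + d * w) (if-≰ᵇ w 0 ρ<a) (m≤n⇒m∸n≡0 (<⇒≤ ρ<a)) ⟩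
  0                                        ≡⟨ cong (_* w) (m≤n⇒m∸n≡0 ρ<a) ⟨
  (suc ρ ∸ a) * w                          ∎
  where
    open ≡-Reasoning
    ρ<a : ρ < a
    ρ<a = ≰⇒> a≰ρ

guarded-step-pred : ∀ k ρ w → (if k ≤ᵇ suc ρ then w else 0) + (ρ ∸ pred k) * w ≡ (suc ρ ∸ pred k) * w
guarded-step-pred k ρ w =
  trans (cong (λ b → (if b then w else 0) + (ρ ∸ pred k) * w) (≤ᵇ-suc-pred k ρ)) (guarded-step (pred k) ρ w)

sum-guarded-countdown : ∀ k ρ w →
  sum (map (λ i → if k ≤ᵇ i then w else 0) (applyDownFrom suc ρ)) ≡ (ρ ∸ pred k) * w
sum-guarded-countdown k zero    w = cong (_* w) (sym (0∸n≡0 (pred k)))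
sum-guarded-countdown k (suc ρ) w =
  trans (cong ((if k ≤ᵇ suc ρ then w else 0) +_) (sum-guarded-countdown k ρ w)) (guarded-step-pred k ρ w)

sumRange-guarded : ∀ a c ρ w → ρ < a + c → sumRange (λ j → if j ≤ᵇ ρ then w else 0) a c ≡ (suc ρ ∸ a) * w
sumRange-guarded a zero    ρ w ρ< = cong (_* w) (sym (m≤n⇒m∸n≡0 (subst (suc ρ ≤_) (+-identityʳ a) ρ<)))
sumRange-guarded a (suc c) ρ w ρ< =
  trans (cong ((if a ≤ᵇ ρ then w else 0) +_) (sumRange-guarded (suc a) c ρ w (subst (ρ <_) (+-suc a c) ρ<)))
        (guarded-step a ρ w)

-- Consequences of the first-return recurrence

-- R r k n abstracts the weight of the Dyck words of size n with at least k
-- returns. A word with ρ returns, counted in R r j n for j ≤ ρ, is counted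
-- ρ + 1 ∸ pred k times by the sum: once for each of its preimages with at
-- least k returns. The guarded terms correct for the zigzag words.
module ReturnRecurrence
    (R : ℕ → ℕ → ℕ → ℕ)
    (R-suc : ∀ r k n →
       R r k (suc n) + (if k ≤ᵇ suc n then zigzagWeight r n else 0)
         ≡ sumRange (λ j → R r j n) (pred k) (suc n ∸ pred k)
           + (if k ≤ᵇ suc n then zigzagWeight r (suc n) else 0))
    (R-init : ∀ r → R r 0 0 ≡ 1)
  where

  R-suc≤ : ∀ r k n → k ≤ suc n →
    R r k (suc n) + zigzagWeight r n ≡ sumRange (λ j → R r j n) (pred k) (suc n ∸ pred k) + zigzagWeight r (suc n)
  R-suc≤ r k n k≤ = begin
    R r k (suc n) + zigzagWeight r n
      ≡⟨ cong (R r k (suc n) +_) (if-≤ᵇ _ 0 k≤) ⟨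
    R r k (suc n) + (if k ≤ᵇ suc n then zigzagWeight r n else 0)
      ≡⟨ R-suc r k n ⟩
    sumRange (λ j → R r j n) (pred k) (suc n ∸ pred k) + (if k ≤ᵇ suc n then zigzagWeight r (suc n) else 0)
      ≡⟨ cong (sumRange (λ j → R r j n) (pred k) (suc n ∸ pred k) +_) (if-≤ᵇ _ 0 k≤) ⟩
    sumRange (λ j → R r j n) (pred k) (suc n ∸ pred k) + zigzagWeight r (suc n) ∎
    where open ≡-Reasoning

  R-vanish : ∀ r k n → suc n < k → R r k (suc n) ≡ 0
  R-vanish r k n n<k = begin
    R r k (suc n)
      ≡⟨ +-identityʳ _ ⟨
    R r k (suc n) + 0
      ≡⟨ cong (R r k (suc n) +_) (if-≰ᵇ _ 0 n<k) ⟨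
    R r k (suc n) + (if k ≤ᵇ suc n then zigzagWeight r n else 0)
      ≡⟨ R-suc r k n ⟩
    sumRange (λ j → R r j n) (pred k) (suc n ∸ pred k) + (if k ≤ᵇ suc n then zigzagWeight r (suc n) else 0)
      ≡⟨ cong₂ (λ c x → sumRange (λ j → R r j n) (pred k) c + x)
               (m≤n⇒m∸n≡0 (pred-mono-≤ n<k)) (if-≰ᵇ _ 0 n<k) ⟩
    0 ∎
    where open ≡-Reasoning

  R-diagonal : ∀ r n → R r n n ≡ zigzagWeight r n
  R-diagonal r zero    = R-init r
  R-diagonal r (suc n) = +-cancelʳ-≡ (zigzagWeight r n) _ _ (begin
    R r (suc n) (suc n) + zigzagWeight r n
      ≡⟨ R-suc≤ r (suc n) n ≤-refl ⟩
    sumRange (λ j → R r j n) n (suc n ∸ n) + zigzagWeight r (suc n)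
      ≡⟨ cong (λ c → sumRange (λ j → R r j n) n c + zigzagWeight r (suc n)) (m+n∸n≡m 1 n) ⟩
    R r n n + 0 + zigzagWeight r (suc n)
      ≡⟨ cong (_+ zigzagWeight r (suc n)) (trans (+-identityʳ _) (R-diagonal r n)) ⟩
    zigzagWeight r n + zigzagWeight r (suc n)
      ≡⟨ +-comm (zigzagWeight r n) _ ⟩
    zigzagWeight r (suc n) + zigzagWeight r n ∎)
    where open ≡-Reasoning

  -- The last summand R r n n cancels against the correction term.
  R-suc-closed : ∀ r k n → k ≤ suc n →
    R r k (suc n) ≡ sumRange (λ j → R r j n) (pred k) (n ∸ pred k) + zigzagWeight r (suc n)
  R-suc-closed r k n k≤ = +-cancelʳ-≡ (zigzagWeight r n) _ _ (begin
    R r k (suc n) + zigzagWeight r n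
      ≡⟨ R-suc≤ r k n k≤ ⟩
    sumRange f (pred k) (suc n ∸ pred k) + zigzagWeight r (suc n)
      ≡⟨ cong (λ c → sumRange f (pred k) c + zigzagWeight r (suc n)) (+-∸-assoc 1 k-1≤n) ⟩
    sumRange f (pred k) (suc (n ∸ pred k)) + zigzagWeight r (suc n)
      ≡⟨ cong (_+ zigzagWeight r (suc n)) (sumRange-snoc f (pred k) (n ∸ pred k)) ⟩
    sumRange f (pred k) (n ∸ pred k) + f (pred k + (n ∸ pred k)) + zigzagWeight r (suc n)
      ≡⟨ cong (λ j → sumRange f (pred k) (n ∸ pred k) + f j + zigzagWeight r (suc n)) (m+[n∸m]≡n k-1≤n) ⟩
    sumRange f (pred k) (n ∸ pred k) + R r n n + zigzagWeight r (suc n)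
      ≡⟨ cong (λ x → sumRange f (pred k) (n ∸ pred k) + x + zigzagWeight r (suc n)) (R-diagonal r n) ⟩
    sumRange f (pred k) (n ∸ pred k) + zigzagWeight r n + zigzagWeight r (suc n)
      ≡⟨ xy∙z≈xz∙y (sumRange f (pred k) (n ∸ pred k)) (zigzagWeight r n) (zigzagWeight r (suc n)) ⟩
    sumRange f (pred k) (n ∸ pred k) + zigzagWeight r (suc n) + zigzagWeight r n ∎)
    where
      open ≡-Reasoning
      f : ℕ → ℕ
      f j = R r j n
      k-1≤n : pred k ≤ n
      k-1≤n = pred-mono-≤ k≤

  -- The analogue of Cat(x)^(r+1) = Cat(x)^r + x Cat(x)^(r+2).
  R-catalan : ∀ n r k → k ≤ n → R (suc r) k (suc n) ≡ R r k (suc n) + R (suc (suc r)) k n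
  R-catalan zero r .zero z≤n = begin
    R (suc r) 0 1                  ≡⟨ R-suc-closed (suc r) 0 0 z≤n ⟩
    zigzagWeight (suc r) 1         ≡⟨ zigzagWeight-one r ⟩
    zigzagWeight r 1 + 1           ≡⟨ cong₂ _+_ (R-suc-closed r 0 0 z≤n) (R-init (suc (suc r))) ⟨
    R r 0 1 + R (suc (suc r)) 0 0  ∎
    where open ≡-Reasoning
  R-catalan (suc n) r k k≤ = +-cancelʳ-≡ (zigzagWeight (suc (suc r)) n) _ _ (begin
    R (suc r) k (suc (suc n)) + zigzagWeight (suc (suc r)) n
      ≡⟨ cong (_+ zigzagWeight (suc (suc r)) n) (R-suc-closed (suc r) k (suc n) (m≤n⇒m≤1+n k≤)) ⟩
    sumRange (λ j → R (suc r) j (suc n)) (pred k) c + zigzagWeight (suc r) (suc (suc n)) + zigzagWeight (suc (suc r)) n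
      ≡⟨ cong (λ s → s + zigzagWeight (suc r) (suc (suc n)) + zigzagWeight (suc (suc r)) n) split ⟩
    A + B + zigzagWeight (suc r) (suc (suc n)) + zigzagWeight (suc (suc r)) n
      ≡⟨ +-assoc (A + B) _ _ ⟩
    A + B + (zigzagWeight (suc r) (suc (suc n)) + zigzagWeight (suc (suc r)) n)
      ≡⟨ cong (A + B +_) (zigzagWeight-exchange r n) ⟩
    A + B + (zigzagWeight r (suc (suc n)) + zigzagWeight (suc (suc r)) (suc n))
      ≡⟨ interchange A B _ _ ⟩
    (A + zigzagWeight r (suc (suc n))) + (B + zigzagWeight (suc (suc r)) (suc n))
      ≡⟨ cong₂ _+_ (R-suc-closed r k (suc n) (m≤n⇒m≤1+n k≤)) (R-suc≤ (suc (suc r)) k n k≤) ⟨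
    R r k (suc (suc n)) + (R (suc (suc r)) k (suc n) + zigzagWeight (suc (suc r)) n)
      ≡⟨ +-assoc (R r k (suc (suc n))) _ _ ⟨
    R r k (suc (suc n)) + R (suc (suc r)) k (suc n) + zigzagWeight (suc (suc r)) n ∎)
    where
      open ≡-Reasoning
      c A B : ℕ
      c = suc n ∸ pred k
      A = sumRange (λ j → R r j (suc n)) (pred k) c
      B = sumRange (λ j → R (suc (suc r)) j n) (pred k) c
      end : pred k + c ≡ suc n
      end = m+[n∸m]≡n (pred-mono-≤ (m≤n⇒m≤1+n k≤))
      split : sumRange (λ j → R (suc r) j (suc n)) (pred k) c ≡ A + B
      split = trans (sumRange-cong _ _ (pred k) c (λ j j<k-1+c → R-catalan n r j (s≤s⁻¹ (subst (j <_) end j<k-1+c))))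
                    (sumRange-+ _ _ (pred k) c)

  R-zeroPower : ∀ n k → R 0 k (suc n) ≡ 0
  R-zeroPower n k with k ≤? suc n
  ... | no  k≰ = R-vanish 0 k n (≰⇒> k≰)
  ... | yes k≤ = trans (R-suc-closed 0 k n k≤) (cong₂ _+_ (lowerSum n) (zigzagWeight-zero n))
    where
      lowerSum : ∀ m → sumRange (λ j → R 0 j m) (pred k) (m ∸ pred k) ≡ 0
      lowerSum zero    = cong (sumRange (λ j → R 0 j 0) (pred k)) (0∸n≡0 (pred k))
      lowerSum (suc m) = sumRange-zero (λ j → R 0 j (suc m)) (pred k) (suc m ∸ pred k) (λ j → R-zeroPower m j)

  -- The ballot form Cat(r, n) = C(2n+r-1, n) - C(2n+r-1, n-1), with r and n shifted by one.
  R-ballot : ∀ n r → R (suc r) 0 (suc n) + (n + suc n + suc r) C n ≡ (n + suc n + suc r) C suc n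
  R-ballot zero zero =
    cong (_+ 1) (trans (R-catalan 0 0 0 z≤n) (cong₂ _+_ (R-zeroPower 0 0) (R-init 2)))
  R-ballot zero (suc r) = begin
    R (suc (suc r)) 0 1 + 1              ≡⟨ cong (_+ 1) (R-catalan 0 (suc r) 0 z≤n) ⟩
    R (suc r) 0 1 + R (3 + r) 0 0 + 1    ≡⟨ cong (λ x → R (suc r) 0 1 + x + 1) (R-init (3 + r)) ⟩
    R (suc r) 0 1 + 1 + 1                ≡⟨ cong (_+ 1) (R-ballot zero r) ⟩
    (2 + r) C 1 + 1                      ≡⟨ +-comm ((2 + r) C 1) 1 ⟩
    1 + (2 + r) C 1                      ≡⟨ C-pascal (2 + r) 0 ⟨
    (3 + r) C 1                          ∎
    where open ≡-Reasoning
  R-ballot (suc n) zero = begin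
    R 1 0 (2 + n) + suc (n + suc (suc n) + 1) C suc n
      ≡⟨ cong₂ (λ x t → x + suc t C suc n) R-one index ⟩
    R 2 0 (suc n) + suc M C suc n
      ≡⟨ cong (R 2 0 (suc n) +_) (C-pascal M n) ⟩
    R 2 0 (suc n) + (M C n + M C suc n)
      ≡⟨ +-assoc (R 2 0 (suc n)) _ _ ⟨
    R 2 0 (suc n) + M C n + M C suc n
      ≡⟨ cong (_+ M C suc n) (R-ballot n 1) ⟩
    M C suc n + M C suc n
      ≡⟨ cong (M C suc n +_) symmetric ⟩
    M C suc n + M C suc (suc n)
      ≡⟨ C-pascal M (suc n) ⟨
    suc M C suc (suc n)
      ≡⟨ cong (λ t → suc t C suc (suc n)) index ⟨
    suc (n + suc (suc n) + 1) C suc (suc n) ∎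
    where
      open ≡-Reasoning
      M : ℕ
      M = n + suc n + 2
      R-one : R 1 0 (2 + n) ≡ R 2 0 (suc n)
      R-one = trans (R-catalan (suc n) 0 0 z≤n) (cong (_+ R 2 0 (suc n)) (R-zeroPower (suc n) 0))
      index : n + suc (suc n) + 1 ≡ M
      index = arith n
        where arith : ∀ n → n + suc (suc n) + 1 ≡ n + suc n + 2
              arith = solve-∀
      M≡ : M ≡ suc n + suc (suc n)
      M≡ = arith n
        where arith : ∀ n → n + suc n + 2 ≡ suc n + suc (suc n)
              arith = solve-∀
      symmetric : M C suc n ≡ M C suc (suc n)
      symmetric = trans (nCk≡nC[n∸k] (subst (suc n ≤_) (sym M≡) (m≤m+n (suc n) _)))
                        (cong (M C_) (trans (cong (_∸ suc n) M≡) (m+n∸m≡n (suc n) (suc (suc n)))))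
  R-ballot (suc n) (suc r) = begin
    R (2 + r) 0 (2 + n) + suc (n + suc (suc n) + suc (suc r)) C suc n
      ≡⟨ cong₂ (λ x t → x + t C suc n) (R-catalan (suc n) (suc r) 0 z≤n) index ⟩
    R (suc r) 0 (2 + n) + R (3 + r) 0 (suc n) + suc N C suc n
      ≡⟨ cong (R (suc r) 0 (2 + n) + R (3 + r) 0 (suc n) +_) (C-pascal N n) ⟩
    R (suc r) 0 (2 + n) + R (3 + r) 0 (suc n) + (N C n + N C suc n)
      ≡⟨ regroup (R (suc r) 0 (2 + n)) _ _ _ ⟩
    (R (3 + r) 0 (suc n) + N C n) + (R (suc r) 0 (2 + n) + N C suc n)
      ≡⟨ cong₂ _+_ (subst (λ t → R (3 + r) 0 (suc n) + t C n ≡ t C suc n) lower (R-ballot n (2 + r)))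
                   (R-ballot (suc n) r) ⟩
    N C suc n + N C suc (suc n)
      ≡⟨ C-pascal N (suc n) ⟨
    suc N C suc (suc n)
      ≡⟨ cong (_C suc (suc n)) index ⟨
    suc (n + suc (suc n) + suc (suc r)) C suc (suc n) ∎
    where
      open ≡-Reasoning
      N : ℕ
      N = suc n + suc (suc n) + suc r
      index : suc (n + suc (suc n) + suc (suc r)) ≡ suc N
      index = cong suc (arith n r)
        where arith : ∀ n r → n + suc (suc n) + suc (suc r) ≡ suc (n + suc (suc n) + suc r)
              arith = solve-∀
      lower : n + suc n + suc (2 + r) ≡ N
      lower = arith n r
        where arith : ∀ n r → n + suc n + suc (2 + r) ≡ suc n + suc (suc n) + suc r
              arith = solve-∀
      regroup : ∀ a b c d → a + b + (c + d) ≡ b + c + (a + d)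
      regroup = solve-∀

  R-catalanNumber : ∀ r n → (n + suc r) * R (suc r) 0 n ≡ suc r * ((2 * n + suc r ∸ 1) C n)
  R-catalanNumber r zero    = cong (suc r *_) (R-init (suc r))
  R-catalanNumber r (suc n) = +-cancelʳ-≡ (suc n * b) _ _ (begin
    D * U + suc n * b                                ≡⟨ cong (D * U +_) absorbed ⟩
    D * U + D * a                                    ≡⟨ *-distribˡ-+ D U a ⟨
    D * (U + a)                                      ≡⟨ cong (D *_) (R-ballot n r) ⟩
    D * b                                            ≡⟨ *-distribʳ-+ b (suc n) (suc r) ⟩
    suc n * b + suc r * b                            ≡⟨ +-comm (suc n * b) _ ⟩
    suc r * b + suc n * b                            ≡⟨ cong (λ t → suc r * (t C suc n) + suc n * b) index ⟩
    suc r * ((2 * suc n + suc r ∸ 1) C suc n) + suc n * b ∎)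
    where
      open ≡-Reasoning
      K D U a b : ℕ
      K = n + suc n + suc r
      D = suc n + suc r
      U = R (suc r) 0 (suc n)
      a = K C n
      b = K C suc n
      absorbed : suc n * b ≡ D * a
      absorbed = +-cancelʳ-≡ (n * a) _ _ (begin
        suc n * b + n * a  ≡⟨ C-absorption K n ⟩
        K * a              ≡⟨ cong (_* a) (+-assoc n (suc n) (suc r)) ⟩
        (n + D) * a        ≡⟨ *-distribʳ-+ a n D ⟩
        n * a + D * a      ≡⟨ +-comm (n * a) _ ⟩
        D * a + n * a      ∎)
      index : K ≡ 2 * suc n + suc r ∸ 1
      index = cong (_∸ 1) (arith n r)
        where arith : ∀ n r → suc (n + suc n + suc r) ≡ 2 * suc n + suc r
              arith = solve-∀

-- Sums over words

sum-map-+ : ∀ {A : Set} (f g : A → ℕ) xs → sum (map (λ x → f x + g x) xs) ≡ sum (map f xs) + sum (map g xs)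
sum-map-+ f g []       = refl
sum-map-+ f g (x ∷ xs) = trans (cong (f x + g x +_) (sum-map-+ f g xs)) (interchange (f x) (g x) _ _)

sum-map-zero : ∀ {A : Set} (xs : List A) → sum (map (λ _ → 0) xs) ≡ 0
sum-map-zero []       = refl
sum-map-zero (_ ∷ xs) = sum-map-zero xs

sum-map-map : ∀ {A B : Set} (F : B → ℕ) (g : A → B) ys → sum (map F (map g ys)) ≡ sum (map (λ y → F (g y)) ys)
sum-map-map F g ys = cong sum (sym (map-∘ ys))

sum-map-concatMap : ∀ {A B : Set} (f : B → ℕ) (g : A → List B) xs →
  sum (map f (concatMap g xs)) ≡ sum (map (λ x → sum (map f (g x))) xs)
sum-map-concatMap f g []       = refl
sum-map-concatMap f g (x ∷ xs) = begin
    sum (map f (g x ++ concatMap g xs))               ≡⟨ cong sum (map-++ f (g x) _) ⟩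
    sum (map f (g x) ++ map f (concatMap g xs))       ≡⟨ sum-++ (map f (g x)) _ ⟩
    sum (map f (g x)) + sum (map f (concatMap g xs))  ≡⟨ cong (sum (map f (g x)) +_) (sum-map-concatMap f g xs) ⟩
    sum (map f (g x)) + sum (map (λ x → sum (map f (g x))) xs) ∎
  where open ≡-Reasoning

sum-map-filterᵇ : ∀ {A : Set} (p : A → Bool) (f : A → ℕ) xs →
  sum (map f (filterᵇ p xs)) ≡ sum (map (λ x → if p x then f x else 0) xs)
sum-map-filterᵇ p f []       = refl
sum-map-filterᵇ p f (x ∷ xs) with p x
... | true  = cong (f x +_) (sum-map-filterᵇ p f xs)
... | false = sum-map-filterᵇ p f xs

sumWords : ℕ → (List Bool → ℕ) → ℕ
sumWords m f = sum (map f (allWords m))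

sumWords-suc : ∀ m f → sumWords (suc m) f ≡ sumWords m (λ w → f (false ∷ w) + f (true ∷ w))
sumWords-suc m f =
  trans (sum-map-concatMap f (λ w → (false ∷ w) ∷ (true ∷ w) ∷ []) (allWords m))
        (cong sum (map-cong (λ w → cong (f (false ∷ w) +_) (+-identityʳ (f (true ∷ w)))) (allWords m)))

sumWords-cong : ∀ m f g → (∀ w → length w ≡ m → f w ≡ g w) → sumWords m f ≡ sumWords m g
sumWords-cong zero    f g f≡g = cong (_+ 0) (f≡g [] refl)
sumWords-cong (suc m) f g f≡g = begin
    sumWords (suc m) f                                   ≡⟨ sumWords-suc m f ⟩
    sumWords m (λ w → f (false ∷ w) + f (true ∷ w))      ≡⟨ sumWords-cong m _ _ (λ w len →
                                                              cong₂ _+_ (f≡g (false ∷ w) (cong suc len))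
                                                                        (f≡g (true ∷ w) (cong suc len))) ⟩
    sumWords m (λ w → g (false ∷ w) + g (true ∷ w))      ≡⟨ sumWords-suc m g ⟨
    sumWords (suc m) g                                   ∎
  where open ≡-Reasoning

sumDyckFrom : ℕ → ℕ → (List Bool → ℕ) → ℕ
sumDyckFrom h m F = sumWords m (λ w → if isDyckFrom h w then F w else 0)

sumDyckFrom-cong : ∀ h m F G → (∀ w → length w ≡ m → isDyckFrom h w ≡ true → F w ≡ G w) →
  sumDyckFrom h m F ≡ sumDyckFrom h m G
sumDyckFrom-cong h m F G F≡G = sumWords-cong m _ _ guarded
  where
    guarded : ∀ w → length w ≡ m → (if isDyckFrom h w then F w else 0) ≡ (if isDyckFrom h w then G w else 0)
    guarded w len with isDyckFrom h w in dyck
    ... | true  = F≡G w len dyck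
    ... | false = refl

sumDyckFrom-+ : ∀ h m F G → sumDyckFrom h m (λ w → F w + G w) ≡ sumDyckFrom h m F + sumDyckFrom h m G
sumDyckFrom-+ h m F G =
  trans (cong sum (map-cong (λ w → if-+ (isDyckFrom h w) (F w) (G w)) (allWords m))) (sum-map-+ _ _ (allWords m))
  where
    if-+ : ∀ b (x y : ℕ) → (if b then x + y else 0) ≡ (if b then x else 0) + (if b then y else 0)
    if-+ true  x y = refl
    if-+ false x y = refl

sumDyckFrom-zero : ∀ h m → sumDyckFrom h m (λ _ → 0) ≡ 0
sumDyckFrom-zero h m = trans (cong sum (map-cong (λ w → if-0 (isDyckFrom h w)) (allWords m))) (sum-map-zero (allWords m))
  where
    if-0 : ∀ b → (if b then 0 else 0) ≡ 0
    if-0 true  = refl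
    if-0 false = refl

sumDyckFrom-sumRange : ∀ h m (F : ℕ → List Bool → ℕ) a c →
  sumDyckFrom h m (λ w → sumRange (λ j → F j w) a c) ≡ sumRange (λ j → sumDyckFrom h m (F j)) a c
sumDyckFrom-sumRange h m F a zero    = sumDyckFrom-zero h m
sumDyckFrom-sumRange h m F a (suc c) =
  trans (sumDyckFrom-+ h m (F a) _) (cong (sumDyckFrom h m (F a) +_) (sumDyckFrom-sumRange h m F (suc a) c))

downStepSum : ℕ → ℕ → (List Bool → ℕ) → ℕ
downStepSum zero    m F = 0
downStepSum (suc h) m F = sumDyckFrom h m (λ w → F (true ∷ w))

sumDyckFrom-suc : ∀ h m F →
  sumDyckFrom h (suc m) F ≡ sumDyckFrom (suc h) m (λ w → F (false ∷ w)) + downStepSum h m F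
sumDyckFrom-suc zero    m F =
  trans (sumWords-suc m _) (trans (sum-map-+ _ _ (allWords m)) (cong (sumDyckFrom 1 m _ +_) (sum-map-zero (allWords m))))
sumDyckFrom-suc (suc h) m F = trans (sumWords-suc m _) (sum-map-+ _ _ (allWords m))

-- Returns and first-return insertions

-- The number of steps of x from height 1 down to height 0, when x is read
-- starting from height h.
returns : ℕ → List Bool → ℕ
returns h             []          = 0
returns h             (false ∷ x) = returns (suc h) x
returns zero          (true ∷ x)  = 0
returns (suc zero)    (true ∷ x)  = suc (returns zero x)
returns (suc (suc h)) (true ∷ x)  = returns (suc h) x

returns-bound : ∀ h x → 2 * returns h x ≤ length x + h
returns-bound h             []          = z≤n
returns-bound h             (false ∷ x) = subst (2 * returns (suc h) x ≤_) (+-suc (length x) h) (returns-bound (suc h) x)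
returns-bound zero          (true ∷ x)  = z≤n
returns-bound (suc zero)    (true ∷ x)  =
  subst₂ _≤_ (sym (double-suc (returns zero x))) (shift (length x)) (+-monoˡ-≤ 2 (returns-bound zero x))
  where
    double-suc : ∀ a → 2 * suc a ≡ 2 * a + 2
    double-suc = solve-∀
    shift : ∀ l → l + 0 + 2 ≡ suc (l + 1)
    shift = solve-∀
returns-bound (suc (suc h)) (true ∷ x)  =
  ≤-trans (returns-bound (suc h) x) (m≤n⇒m≤1+n (+-monoʳ-≤ (length x) (n≤1+n (suc h))))

returns-dyck : ∀ n x → length x ≡ 2 * n → returns 0 x ≤ n
returns-dyck n x len = *-cancelˡ-≤ 2 (subst (2 * returns 0 x ≤_) (trans (+-identityʳ _) len) (returns-bound 0 x))

-- insertions d x lists the words obtained from x by inserting a letter 1 that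
-- becomes the first step of the word going d + 1 levels below its start.
mutual
  insertions : ℕ → List Bool → List (List Bool)
  insertions zero    x           = (true ∷ x) ∷ laterInsertions x
  insertions (suc d) []          = []
  insertions (suc d) (false ∷ x) = map (false ∷_) (insertions (suc (suc d)) x)
  insertions (suc d) (true ∷ x)  = map (true ∷_) (insertions d x)

  laterInsertions : List Bool → List (List Bool)
  laterInsertions []          = []
  laterInsertions (false ∷ x) = map (false ∷_) (insertions 1 x)
  laterInsertions (true ∷ x)  = []

-- Inserting a first return at a level d ≤ h is a bijection onto the words Dyck from height h + 1.
sumDyckFrom-insertions : ∀ m h d → d ≤ h → ∀ F →
  sumDyckFrom (suc h) (suc m) F ≡ sumDyckFrom h m (λ x → sum (map F (insertions d x)))
sumDyckFrom-insertions zero    zero    zero    z≤n F = sym (+-identityʳ _)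
sumDyckFrom-insertions zero    (suc h) d       d≤h F = refl
sumDyckFrom-insertions (suc m) h       zero    z≤n F = begin
    sumDyckFrom (suc h) (suc (suc m)) F
      ≡⟨ sumDyckFrom-suc (suc h) (suc m) F ⟩
    sumDyckFrom (suc (suc h)) (suc m) (λ w → F (false ∷ w)) + sumDyckFrom h (suc m) (λ w → F (true ∷ w))
      ≡⟨ cong₂ _+_ (sumDyckFrom-insertions m (suc h) 1 (s≤s z≤n) (λ w → F (false ∷ w)))
                   (sumDyckFrom-suc h m (λ w → F (true ∷ w))) ⟩
    sumDyckFrom (suc h) m later + (sumDyckFrom (suc h) m first + downStepSum h m (λ w → F (true ∷ w)))
      ≡⟨ cong (sumDyckFrom (suc h) m later +_) (cong (sumDyckFrom (suc h) m first +_) (downStepSum-cong h)) ⟩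
    sumDyckFrom (suc h) m later + (sumDyckFrom (suc h) m first + downStepSum h m G)
      ≡⟨ x∙yz≈yx∙z (sumDyckFrom (suc h) m later) (sumDyckFrom (suc h) m first) (downStepSum h m G) ⟩
    sumDyckFrom (suc h) m first + sumDyckFrom (suc h) m later + downStepSum h m G
      ≡⟨ cong (_+ downStepSum h m G) (sumDyckFrom-+ (suc h) m first later) ⟨
    sumDyckFrom (suc h) m (λ x → first x + later x) + downStepSum h m G
      ≡⟨ cong (_+ downStepSum h m G) (sumDyckFrom-cong (suc h) m _ _ λ x _ _ →
           cong (first x +_) (sym (sum-map-map F (false ∷_) (insertions 1 x)))) ⟩
    sumDyckFrom (suc h) m (λ x → G (false ∷ x)) + downStepSum h m G
      ≡⟨ sumDyckFrom-suc h m G ⟨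
    sumDyckFrom h (suc m) G ∎
  where
    open ≡-Reasoning
    G : List Bool → ℕ
    G x = sum (map F (insertions zero x))
    first : List Bool → ℕ
    first x = F (true ∷ false ∷ x)
    later : List Bool → ℕ
    later x = sum (map (λ w → F (false ∷ w)) (insertions 1 x))
    downStepSum-cong : ∀ h → downStepSum h m (λ w → F (true ∷ w)) ≡ downStepSum h m G
    downStepSum-cong zero    = refl
    downStepSum-cong (suc h) = sumDyckFrom-cong h m _ _ (λ w _ _ → sym (+-identityʳ _))
sumDyckFrom-insertions (suc m) (suc h) (suc d) (s≤s d≤h) F = begin
    sumDyckFrom (suc (suc h)) (suc (suc m)) F
      ≡⟨ sumDyckFrom-suc (suc (suc h)) (suc m) F ⟩
    sumDyckFrom (suc (suc (suc h))) (suc m) (λ w → F (false ∷ w)) + sumDyckFrom (suc h) (suc m) (λ w → F (true ∷ w))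
      ≡⟨ cong₂ _+_ (sumDyckFrom-insertions m (suc (suc h)) (suc (suc d)) (s≤s (s≤s d≤h)) (λ w → F (false ∷ w)))
                   (sumDyckFrom-insertions m h d d≤h (λ w → F (true ∷ w))) ⟩
    sumDyckFrom (suc (suc h)) m (λ x → sum (map (λ w → F (false ∷ w)) (insertions (suc (suc d)) x)))
      + sumDyckFrom h m (λ x → sum (map (λ w → F (true ∷ w)) (insertions d x)))
      ≡⟨ cong₂ _+_ (sumDyckFrom-cong (suc (suc h)) m _ _
                      (λ x _ _ → sym (sum-map-map F (false ∷_) (insertions (suc (suc d)) x))))
                   (sumDyckFrom-cong h m _ _ (λ x _ _ → sym (sum-map-map F (true ∷_) (insertions d x)))) ⟩
    sumDyckFrom (suc (suc h)) m (λ x → G (false ∷ x)) + downStepSum (suc h) m G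
      ≡⟨ sumDyckFrom-suc (suc h) m G ⟨
    sumDyckFrom (suc h) (suc m) G ∎
  where
    open ≡-Reasoning
    G : List Bool → ℕ
    G x = sum (map F (insertions (suc d) x))

FirstReturnSplits : ℕ → List Bool → List Bool → Set
FirstReturnSplits d x y = ∃[ uv ] firstReturn d y ≡ just uv × (let (u , v) = uv in u ++ v ≡ x)

firstReturnSplits-up : ∀ {h x y} → FirstReturnSplits (suc h) x y → FirstReturnSplits h (false ∷ x) (false ∷ y)
firstReturnSplits-up ((u , v) , split , refl) rewrite split = (false ∷ u , v) , refl , refl

firstReturnSplits-down : ∀ {h x y} → FirstReturnSplits h x y → FirstReturnSplits (suc h) (true ∷ x) (true ∷ y)
firstReturnSplits-down ((u , v) , split , refl) rewrite split = (true ∷ u , v) , refl , refl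

mutual
  insertions-firstReturn : ∀ d x → All (FirstReturnSplits d x) (insertions d x)
  insertions-firstReturn zero    x           = (([] , x) , refl , refl) ∷ laterInsertions-firstReturn x
  insertions-firstReturn (suc d) []          = []
  insertions-firstReturn (suc d) (false ∷ x) =
    map⁺ (All.map (λ {y} → firstReturnSplits-up {suc d} {x} {y}) (insertions-firstReturn (suc (suc d)) x))
  insertions-firstReturn (suc d) (true ∷ x)  =
    map⁺ (All.map (λ {y} → firstReturnSplits-down {d} {x} {y}) (insertions-firstReturn d x))

  laterInsertions-firstReturn : ∀ x → All (FirstReturnSplits zero x) (laterInsertions x)
  laterInsertions-firstReturn []          = []
  laterInsertions-firstReturn (false ∷ x) =
    map⁺ (All.map (λ {y} → firstReturnSplits-up {zero} {x} {y}) (insertions-firstReturn 1 x))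
  laterInsertions-firstReturn (true ∷ x)  = []

laterInsertions-reduce : ∀ x → All (λ y → reduce (false ∷ y) ≡ x) (laterInsertions x)
laterInsertions-reduce x = All.map (λ {y} → reduce-split {y}) (laterInsertions-firstReturn x)
  where
    reduce-split : ∀ {y} → FirstReturnSplits zero x y → reduce (false ∷ y) ≡ x
    reduce-split (_ , split , u++v≡x) rewrite split = u++v≡x

mutual
  returns-insertions : ∀ d x → map (returns (suc (suc d))) (insertions (suc d) x) ≡ applyDownFrom suc (returns (suc d) x)
  returns-insertions d             []          = refl
  returns-insertions d             (false ∷ x) =
    trans (sym (map-∘ {g = returns (suc (suc d))} {f = false ∷_} (insertions (suc (suc d)) x)))
          (returns-insertions (suc d) x)
  returns-insertions zero          (true ∷ x)  =
    trans (sym (map-∘ {g = returns 2} {f = true ∷_} (insertions zero x)))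
          (cong (suc (returns zero x) ∷_) (returns-laterInsertions x))
  returns-insertions (suc d)       (true ∷ x)  =
    trans (sym (map-∘ {g = returns (suc (suc (suc d)))} {f = true ∷_} (insertions (suc d) x)))
          (returns-insertions d x)

  returns-laterInsertions : ∀ x → map (returns 1) (laterInsertions x) ≡ applyDownFrom suc (returns 0 x)
  returns-laterInsertions []          = refl
  returns-laterInsertions (false ∷ x) =
    trans (sym (map-∘ {g = returns 1} {f = false ∷_} (insertions 1 x))) (returns-insertions zero x)
  returns-laterInsertions (true ∷ x)  = refl

-- The weight sums satisfy the first-return recurrence

wtSize-zigzag : ∀ r n x → isZigzag x ≡ true → wtSize r n x ≡ zigzagWeight r n
wtSize-zigzag r zero    x zigzag = refl
wtSize-zigzag r (suc n) x zigzag rewrite zigzag = refl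

laterInsertions-wtSize : ∀ r n x → All (λ y → wtSize r (suc n) (false ∷ y) ≡ wtSize r n x) (laterInsertions x)
laterInsertions-wtSize r n []          = []
laterInsertions-wtSize r n (false ∷ x) =
  map⁺ (All.map (λ {y} → cong (wtSize r n)) (map⁻ (laterInsertions-reduce (false ∷ x))))
laterInsertions-wtSize r n (true ∷ x)  = []

onZigzag : (ℕ → ℕ) → List Bool → ℕ
onZigzag g x = if isZigzag x then g (returns 0 x) else 0

sumDyckFrom-onZigzag : ∀ n g → sumDyckFrom 0 (2 * n) (onZigzag g) ≡ g n
sumDyckFrom-onZigzag zero    g = +-identityʳ (g 0)
sumDyckFrom-onZigzag (suc n) g = begin
    sumDyckFrom 0 (2 * suc n) (onZigzag g)
      ≡⟨ cong (λ m → sumDyckFrom 0 m (onZigzag g)) (*-suc 2 n) ⟩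
    sumDyckFrom 0 (suc (suc (2 * n))) (onZigzag g)
      ≡⟨ trans (sumDyckFrom-suc 0 (suc (2 * n)) _) (+-identityʳ _) ⟩
    sumDyckFrom 1 (suc (2 * n)) (λ w → onZigzag g (false ∷ w))
      ≡⟨ sumDyckFrom-suc 1 (2 * n) _ ⟩
    sumDyckFrom 2 (2 * n) (λ _ → 0) + sumDyckFrom 0 (2 * n) (onZigzag (λ ρ → g (suc ρ)))
      ≡⟨ cong (_+ sumDyckFrom 0 (2 * n) (onZigzag (λ ρ → g (suc ρ)))) (sumDyckFrom-zero 2 (2 * n)) ⟩
    sumDyckFrom 0 (2 * n) (onZigzag (λ ρ → g (suc ρ)))
      ≡⟨ sumDyckFrom-onZigzag n (λ ρ → g (suc ρ)) ⟩
    g (suc n) ∎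
  where open ≡-Reasoning

guardedWeight : ℕ → ℕ → ℕ → List Bool → ℕ
guardedWeight r n k w = if k ≤ᵇ returns 0 w then wtSize r n w else 0

weightAtLeast : ℕ → ℕ → ℕ → ℕ
weightAtLeast r k n = sumDyckFrom 0 (2 * n) (guardedWeight r n k)

laterInsertions-guardedWeight : ∀ r n k x →
  sum (map (λ y → guardedWeight r (suc n) k (false ∷ y)) (laterInsertions x)) ≡ (returns 0 x ∸ pred k) * wtSize r n x
laterInsertions-guardedWeight r n k x = begin
    sum (map (λ y → guardedWeight r (suc n) k (false ∷ y)) (laterInsertions x))
      ≡⟨ cong sum (map-cong-local (All.map (λ {y} → cong (λ v → if k ≤ᵇ returns 1 y then v else 0))
                                           (laterInsertions-wtSize r n x))) ⟩
    sum (map (λ y → guard (returns 1 y)) (laterInsertions x))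
      ≡⟨ cong sum (map-∘ {g = guard} {f = returns 1} (laterInsertions x)) ⟩
    sum (map guard (map (returns 1) (laterInsertions x)))
      ≡⟨ cong (λ is → sum (map guard is)) (returns-laterInsertions x) ⟩
    sum (map guard (applyDownFrom suc (returns 0 x)))
      ≡⟨ sum-guarded-countdown k (returns 0 x) (wtSize r n x) ⟩
    (returns 0 x ∸ pred k) * wtSize r n x ∎
  where
    open ≡-Reasoning
    guard : ℕ → ℕ
    guard i = if k ≤ᵇ i then wtSize r n x else 0

sumRange-guardedWeight : ∀ r n k x → returns 0 x ≤ n →
  sumRange (λ j → guardedWeight r n j x) (pred k) (suc n ∸ pred k) ≡ (suc (returns 0 x) ∸ pred k) * wtSize r n x
sumRange-guardedWeight r n k x ρ≤n =
  sumRange-guarded (pred k) (suc n ∸ pred k) (returns 0 x) (wtSize r n x) (≤-trans (s≤s ρ≤n) (m≤n+m∸n (suc n) (pred k)))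

-- The left side sums over the preimages of x under reduce.
preimageSum : ∀ r n k x → returns 0 x ≤ n →
  sum (map (λ y → guardedWeight r (suc n) k (false ∷ y)) (insertions 0 x))
    + onZigzag (λ ρ → if k ≤ᵇ suc ρ then zigzagWeight r n else 0) x
  ≡ sumRange (λ j → guardedWeight r n j x) (pred k) (suc n ∸ pred k)
    + onZigzag (λ ρ → if k ≤ᵇ suc ρ then zigzagWeight r (suc n) else 0) x
preimageSum r n k x ρ≤n with isZigzag x | wtSize-zigzag r n x
... | false | _ = begin
    guarded w + sum (map (λ y → guardedWeight r (suc n) k (false ∷ y)) (laterInsertions x)) + 0
      ≡⟨ cong (λ t → guarded w + t + 0) (laterInsertions-guardedWeight r n k x) ⟩
    guarded w + (ρ ∸ pred k) * w + 0
      ≡⟨ cong (_+ 0) (guarded-step-pred k ρ w) ⟩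
    (suc ρ ∸ pred k) * w + 0
      ≡⟨ cong (_+ 0) (sumRange-guardedWeight r n k x ρ≤n) ⟨
    sumRange (λ j → guardedWeight r n j x) (pred k) (suc n ∸ pred k) + 0 ∎
  where
    open ≡-Reasoning
    ρ w : ℕ
    ρ = returns 0 x
    w = wtSize r n x
    guarded : ℕ → ℕ
    guarded v = if k ≤ᵇ suc ρ then v else 0
... | true | wz = begin
    guarded (zigzagWeight r (suc n)) + sum (map (λ y → guardedWeight r (suc n) k (false ∷ y)) (laterInsertions x))
      + guarded (zigzagWeight r n)
      ≡⟨ cong (λ t → guarded (zigzagWeight r (suc n)) + t + guarded (zigzagWeight r n))
              (laterInsertions-guardedWeight r n k x) ⟩
    guarded (zigzagWeight r (suc n)) + (ρ ∸ pred k) * w + guarded (zigzagWeight r n)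
      ≡⟨ xy∙z≈zy∙x (guarded (zigzagWeight r (suc n))) _ _ ⟩
    guarded (zigzagWeight r n) + (ρ ∸ pred k) * w + guarded (zigzagWeight r (suc n))
      ≡⟨ cong (λ v → guarded v + (ρ ∸ pred k) * w + guarded (zigzagWeight r (suc n))) (wz refl) ⟨
    guarded w + (ρ ∸ pred k) * w + guarded (zigzagWeight r (suc n))
      ≡⟨ cong (_+ guarded (zigzagWeight r (suc n))) (guarded-step-pred k ρ w) ⟩
    (suc ρ ∸ pred k) * w + guarded (zigzagWeight r (suc n))
      ≡⟨ cong (_+ guarded (zigzagWeight r (suc n))) (sumRange-guardedWeight r n k x ρ≤n) ⟨
    sumRange (λ j → guardedWeight r n j x) (pred k) (suc n ∸ pred k) + guarded (zigzagWeight r (suc n)) ∎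
  where
    open ≡-Reasoning
    ρ w : ℕ
    ρ = returns 0 x
    w = wtSize r n x
    guarded : ℕ → ℕ
    guarded v = if k ≤ᵇ suc ρ then v else 0

weightAtLeast-suc : ∀ r k n →
  weightAtLeast r k (suc n) + (if k ≤ᵇ suc n then zigzagWeight r n else 0)
    ≡ sumRange (λ j → weightAtLeast r j n) (pred k) (suc n ∸ pred k)
      + (if k ≤ᵇ suc n then zigzagWeight r (suc n) else 0)
weightAtLeast-suc r k n = begin
    weightAtLeast r k (suc n) + correction (zigzagWeight r n) n
      ≡⟨ cong₂ _+_ byReduction (sym (sumDyckFrom-onZigzag n (correction (zigzagWeight r n)))) ⟩
    sumDyckFrom 0 (2 * n) preimages + sumDyckFrom 0 (2 * n) (onZigzag (correction (zigzagWeight r n)))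
      ≡⟨ sumDyckFrom-+ 0 (2 * n) _ _ ⟨
    sumDyckFrom 0 (2 * n) (λ x → preimages x + onZigzag (correction (zigzagWeight r n)) x)
      ≡⟨ sumDyckFrom-cong 0 (2 * n) _ _ (λ x len _ → preimageSum r n k x (returns-dyck n x len)) ⟩
    sumDyckFrom 0 (2 * n) (λ x → lower x + onZigzag (correction (zigzagWeight r (suc n))) x)
      ≡⟨ sumDyckFrom-+ 0 (2 * n) _ _ ⟩
    sumDyckFrom 0 (2 * n) lower + sumDyckFrom 0 (2 * n) (onZigzag (correction (zigzagWeight r (suc n))))
      ≡⟨ cong₂ _+_ (sumDyckFrom-sumRange 0 (2 * n) (guardedWeight r n) (pred k) (suc n ∸ pred k))
                   (sumDyckFrom-onZigzag n (correction (zigzagWeight r (suc n)))) ⟩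
    sumRange (λ j → weightAtLeast r j n) (pred k) (suc n ∸ pred k) + correction (zigzagWeight r (suc n)) n ∎
  where
    open ≡-Reasoning
    correction : ℕ → ℕ → ℕ
    correction c ρ = if k ≤ᵇ suc ρ then c else 0
    preimages : List Bool → ℕ
    preimages x = sum (map (λ y → guardedWeight r (suc n) k (false ∷ y)) (insertions 0 x))
    lower : List Bool → ℕ
    lower x = sumRange (λ j → guardedWeight r n j x) (pred k) (suc n ∸ pred k)
    byReduction : weightAtLeast r k (suc n) ≡ sumDyckFrom 0 (2 * n) preimages
    byReduction = begin
      sumDyckFrom 0 (2 * suc n) (guardedWeight r (suc n) k)
        ≡⟨ cong (λ m → sumDyckFrom 0 m (guardedWeight r (suc n) k)) (*-suc 2 n) ⟩
      sumDyckFrom 0 (suc (suc (2 * n))) (guardedWeight r (suc n) k)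
        ≡⟨ trans (sumDyckFrom-suc 0 (suc (2 * n)) _) (+-identityʳ _) ⟩
      sumDyckFrom 1 (suc (2 * n)) (λ y → guardedWeight r (suc n) k (false ∷ y))
        ≡⟨ sumDyckFrom-insertions (2 * n) 0 0 z≤n _ ⟩
      sumDyckFrom 0 (2 * n) preimages ∎

dyckWeightSum≡weightAtLeast : ∀ r n → dyckWeightSum r n ≡ weightAtLeast r 0 n
dyckWeightSum≡weightAtLeast r n = sum-map-filterᵇ isDyck (wtSize r n) (allWords (2 * n))

open ReturnRecurrence weightAtLeast weightAtLeast-suc (λ _ → refl)

mainTheorem1 : (r : ℕ) → 1 ≤ r → (n : ℕ) →
    catDen r n * dyckWeightSum r n ≡ catNum r n
mainTheorem1 (suc r) _ n = begin
    (n + suc r) * dyckWeightSum (suc r) n     ≡⟨ cong ((n + suc r) *_) (dyckWeightSum≡weightAtLeast (suc r) n) ⟩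
    (n + suc r) * weightAtLeast (suc r) 0 n   ≡⟨ R-catalanNumber r n ⟩
    suc r * ((2 * n + suc r ∸ 1) C n)         ∎
  where open ≡-Reasoning
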